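{- Let $\mathcal{H}$ be an $r$-uniform hypergraph and let $P$ be a Berge path in $\mathcal{H}$ with a terminal vertex $v_0$. Let $\mathcal{P}(P,v_0)$ be the set of all Berge paths $Q$ in $\mathcal{H}$ having $v_0$ as a terminal vertex, with the same set of defining vertices as $P$ and the same set of defining edges as $P$. For $Q\in\mathcal{P}(P,v_0)$ let $\tau(Q)$ be the terminal vertex of $Q$ other than $v_0$, and for $\mathcal{P}'\subseteq\mathcal{P}(P,v_0)$ let $\tau(\mathcal{P}')=\{\tau(Q):Q\in\mathcal{P}'\}$. Then there exists a nonempty set $\mathcal{P}'\subseteq\mathcal{P}(P,v_0)$ such that $$|N_{E(P)}(\tau(\mathcal{P}'))|\le 2|\tau(\mathcal{P}')|-1,$$ where $E(P)$ is the set of defining edges of $P$.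
   Context: A Berge path of length $k$ is an alternating sequence $v_0e_1v_1\cdots v_{k-1}e_kv_k$ of distinct vertices (defining vertices) and distinct edges (defining edges) with $v_{i-1},v_i\in e_i$; $v_0$ and $v_k$ are its terminal vertices. For $S\subseteq V(\mathcal{H})$ and a set of edges $\mathcal{F}$, $N_{\mathcal{F}}(S)=\{e\in\mathcal{F}: e\cap S\ne\emptyset\}$. -}

module Defs where

open import Data.Nat using (ℕ; suc)
open import Data.Bool using (Bool; true; false; _∧_; _∨_)
open import Data.Fin using (Fin; zero; inject₁; fromℕ) renaming (suc to fsuc)
open import Data.Fin.Subset using (Subset; _∈_; ⁅_⁆; _∪_; ⊥; ∣_∣)
open import Data.Vec using (Vec; foldr′; zipWith; tabulate)
open import Data.List using (List; []; _∷_)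
open import Data.List.Relation.Unary.All using (All)
open import Data.Product using (∃; _×_)
open import Function.Definitions using (Injective)
open import Relation.Binary.PropositionalEquality using (_≡_)

Hypergraph : ℕ → ℕ → Set
Hypergraph n m = Fin m → Subset n

Uniform : ∀ {n m} → ℕ → Hypergraph n m → Set
Uniform r H = ∀ e → ∣ H e ∣ ≡ r

Simple : ∀ {n m} → Hypergraph n m → Set
Simple H = Injective _≡_ _≡_ H

-- Berge path v_0 e_1 v_1 ... e_k v_k (vertices indexed 0..k, edges 1..k as Fin k)
record BergePath {n m : ℕ} (H : Hypergraph n m) : Set where
  field
    len      : ℕ
    vert     : Fin (suc len) → Fin n
    edge     : Fin len → Fin m
    vert-inj : Injective _≡_ _≡_ vert
    edge-inj : Injective _≡_ _≡_ edge
    left∈    : ∀ i → vert (inject₁ i) ∈ H (edge i)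
    right∈   : ∀ i → vert (fsuc i) ∈ H (edge i)
open BergePath public

module _ {n m : ℕ} {H : Hypergraph n m} where

  firstV : BergePath H → Fin n
  firstV P = vert P zero

  lastV : BergePath H → Fin n
  lastV P = vert P (fromℕ (len P))

  IsTerminal : Fin n → BergePath H → Set
  IsTerminal v P = (v ≡ firstV P) Data.Sum.⊎ (v ≡ lastV P)
    where import Data.Sum

  SameVertexSet : BergePath H → BergePath H → Set
  SameVertexSet P Q = ∀ x → ((∃ λ i → vert P i ≡ x) → (∃ λ j → vert Q j ≡ x))
                          × ((∃ λ j → vert Q j ≡ x) → (∃ λ i → vert P i ≡ x))

  SameEdgeSet : BergePath H → BergePath H → Set
  SameEdgeSet P Q = ∀ e → ((∃ λ i → edge P i ≡ e) → (∃ λ j → edge Q j ≡ e))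
                        × ((∃ λ j → edge Q j ≡ e) → (∃ λ i → edge P i ≡ e))

  -- 𝒫(P, v₀): Berge paths with v₀ as terminal vertex (oriented so that v₀ is
  -- the first vertex), same defining vertex set and same defining edge set as P.
  InFamily : BergePath H → Fin n → BergePath H → Set
  InFamily P v₀ Q = firstV Q ≡ v₀ × SameVertexSet P Q × SameEdgeSet P Q

  τ : BergePath H → Fin n
  τ = lastV

  τset : List (BergePath H) → Subset n
  τset []       = ⊥
  τset (Q ∷ Qs) = ⁅ τ Q ⁆ ∪ τset Qs

  meets : Subset n → Subset n → Bool
  meets s t = foldr′ _∨_ false (zipWith _∧_ s t)

  -- N_{E(P)}(S), as the set of (indices of) defining edges of P meeting S;
  -- indices are in bijection with E(P) since defining edges are distinct.
  NbrEdges : (P : BergePath H) → Subset n → Subset (len P)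
  NbrEdges P S = tabulate (λ i → meets (H (edge P i)) S)

-- Pósa rotations.  If the last vertex of Q = u₀ f₁ u₁ ⋯ f_k u_k lies in f_j, then
-- u₀ f₁ ⋯ u_{j-1} f_j u_k f_k u_{k-1} ⋯ f_{j+1} u_j has the same vertices and edges and ends at u_j.
-- Start from P, reversed if v₀ is its last vertex, keep adding rotations that produce a new
-- end, and let R be the final set of ends.  A rotation keeps every edge but f_j between the
-- same two vertices, and the far end u_j of f_j joins R; so an edge e_i of P with
-- v_{i-1}, v_i ∉ R still joins v_{i-1} and v_i in every path found, and if it contained the
-- end of such a path, rotating there would give a new end outside R.  Hence every edge of P
-- meeting R has v_{i-1} ∈ R or v_i ∈ R.  A vertex of R is v_{i-1} for at most one i and v_i
-- for at most one i, and an end of P lies in R and has only one of these, so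
-- |N_{E(P)}(R)| ≤ 2|R| - 1.

module Submission where

open import Defs
open import Data.Bool using (Bool; true; false; _∨_)
open import Data.Fin using (Fin; toℕ; fromℕ; fromℕ<; inject₁) renaming (zero to fzero; suc to fsuc)
open import Data.Fin.Properties
  using (any?; fromℕ≢inject₁; inject₁-injective; toℕ<n; toℕ-fromℕ<; toℕ-injective; toℕ-inject₁; toℕ-fromℕ)
  renaming (suc-injective to fsuc-injective; 0≢1+n to fzero≢fsuc)
open import Data.Fin.Subset using (Subset; _∈_; _∉_; _⊆_; _⊃_; _∪_; _-_; ⁅_⁆; ∣_∣; Nonempty)
open import Data.Fin.Subset.Induction using (⊃-wellFounded)
open import Data.Fin.Subset.Properties
  using (_∈?_; p⊆q⇒∣p∣≤∣q∣; x∈p⇒∣p-x∣<∣p∣; x∈p∧x≢y⇒x∈p-y; x∈p∩q⁻; x∈p∪q⁺; x∈p∪q⁻; q⊆p∪q; x∈⁅x⁆; x∈⁅y⁆⇒x≡y; ∉⊥)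
open import Data.List using (List; []; _∷_)
open import Data.List.Relation.Unary.All as All using (All; []; _∷_; lookupAny)
open import Data.List.Relation.Unary.Any as Any using (Any; here; there)
open import Data.Nat using (ℕ; zero; suc; _+_; _*_; _∸_; _≤_; _<_; z≤n; s≤s; s≤s⁻¹; _<?_; _≟_)
open import Data.Nat.Properties
  using ( +-comm; +-suc; +-identityʳ; +-∸-assoc; ∸-+-assoc; m+[n∸m]≡n; m∸[m∸n]≡n; n∸n≡0; suc-injective
        ; ≤-refl; ≤-reflexive; ≤-trans; <⇒≤; <⇒≱; ≮⇒≥; m≤m+n; n≤1+n; m≤n⇒m≤1+n; <-cmp; <-≤-connex
        ; +-monoʳ-≤; +-monoˡ-<; +-mono-≤-<; +-mono-<-≤; ∸-monoˡ-≤; module ≤-Reasoning)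
open import Data.Product as Product using (∃; _×_; _,_; proj₁; proj₂)
open import Data.Sum as Sum using (_⊎_; inj₁; inj₂)
open import Data.Vec as Vec using ([]; _∷_; tabulate; lookup; foldr′)
open import Data.Vec.Properties using ([]=⇒lookup; lookup⇒[]=; lookup∘tabulate)
open import Function using (_∘_; id)
open import Function.Definitions using (Injective)
open import Induction.WellFounded using (Acc; acc)
open import Relation.Binary using (tri<; tri≈; tri>)
open import Relation.Binary.PropositionalEquality
  using (_≡_; _≢_; refl; sym; trans; cong; subst; subst₂; module ≡-Reasoning)
open import Relation.Nullary using (yes; no; contradiction)
open import Relation.Nullary.Decidable using (_×-dec_; ¬?; decidable-stable)

reflect : ℕ → ℕ → ℕ → ℕ
reflect a N x with x <? a
... | yes _ = x
... | no  _ = a + (N ∸ suc x)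

module _ {a x : ℕ} (N : ℕ) where

  reflect-fixed : x < a → reflect a N x ≡ x
  reflect-fixed x<a with x <? a
  ... | yes _   = refl
  ... | no  x≮a = contradiction x<a x≮a

  reflect-moved : a ≤ x → reflect a N x ≡ a + (N ∸ suc x)
  reflect-moved a≤x with x <? a
  ... | yes x<a = contradiction a≤x (<⇒≱ x<a)
  ... | no  _   = refl

reflect-< : ∀ a {N x} → x < N → reflect a N x < N
reflect-< a {N} {x} x<N with x <? a
... | yes _   = x<N
... | no  x≮a = begin-strict
  a + (N ∸ suc x)     <⟨ +-monoˡ-< (N ∸ suc x) (s≤s (≮⇒≥ x≮a)) ⟩
  suc x + (N ∸ suc x) ≡⟨ m+[n∸m]≡n x<N ⟩
  N                   ∎
  where open ≤-Reasoning

reflect-involutive : ∀ a {N x} → x < N → reflect a N (reflect a N x) ≡ x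
reflect-involutive a {N} {x} x<N with x <? a
... | yes x<a = reflect-fixed N x<a
... | no  x≮a = begin
  reflect a N (a + d)     ≡⟨ reflect-moved N (m≤m+n a d) ⟩
  a + (N ∸ suc (a + d))   ≡⟨ cong (λ e → a + (N ∸ e)) (+-comm (suc a) d) ⟩
  a + (N ∸ (d + suc a))   ≡⟨ cong (a +_) (∸-+-assoc N d (suc a)) ⟨
  a + (N ∸ d ∸ suc a)     ≡⟨ cong (λ e → a + (e ∸ suc a)) (m∸[m∸n]≡n x<N) ⟩
  a + (x ∸ a)             ≡⟨ m+[n∸m]≡n (≮⇒≥ x≮a) ⟩
  x                       ∎
  where
  open ≡-Reasoning
  d = N ∸ suc x

reflect-start : ∀ {a k} → a ≤ k → reflect a (suc k) a ≡ k
reflect-start {a} {k} a≤k = trans (reflect-moved (suc k) (≤-refl {a})) (m+[n∸m]≡n a≤k)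

reflect-end : ∀ {a k} → a ≤ k → reflect a (suc k) k ≡ a
reflect-end {a} {k} a≤k = begin
  reflect a (suc k) k ≡⟨ reflect-moved (suc k) a≤k ⟩
  a + (k ∸ k)         ≡⟨ cong (a +_) (n∸n≡0 k) ⟩
  a + 0               ≡⟨ +-identityʳ a ⟩
  a                   ∎
  where open ≡-Reasoning

reflect-suc : ∀ {a k x} → a ≤ x → x < k → reflect a (suc k) x ≡ suc (reflect a k x)
reflect-suc {a} {k} {x} a≤x x<k = begin
  reflect a (suc k) x     ≡⟨ reflect-moved (suc k) a≤x ⟩
  a + (k ∸ x)             ≡⟨ cong (a +_) (+-∸-assoc 1 x<k) ⟩
  a + suc (k ∸ suc x)     ≡⟨ +-suc a (k ∸ suc x) ⟩
  suc (a + (k ∸ suc x))   ≡⟨ cong suc (reflect-moved k a≤x) ⟨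
  suc (reflect a k x)     ∎
  where open ≡-Reasoning

reflect-suc-suc : ∀ {a k x} → a ≤ x → reflect a (suc k) (suc x) ≡ reflect a k x
reflect-suc-suc {k = k} a≤x = trans (reflect-moved (suc k) (m≤n⇒m≤1+n a≤x)) (sym (reflect-moved k a≤x))

SlotEnd : ℕ → ℕ → Set
SlotEnd s y = y ≡ s ⊎ y ≡ suc s

reflect-left : ∀ a {k x} → x < k → SlotEnd (reflect a k x) (reflect a (suc k) x)
reflect-left a {k} {x} x<k with <-≤-connex x a
... | inj₁ x<a = inj₁ (trans (reflect-fixed (suc k) x<a) (sym (reflect-fixed k x<a)))
... | inj₂ a≤x = inj₂ (reflect-suc a≤x x<k)

reflect-right : ∀ a {k x} → x < k → suc x ≢ a → SlotEnd (reflect a k x) (reflect a (suc k) (suc x))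
reflect-right a {k} {x} x<k sx≢a with <-cmp (suc x) a
... | tri< sx<a _ _ = inj₂ (trans (reflect-fixed (suc k) sx<a) (cong suc (sym (reflect-fixed k (<⇒≤ sx<a)))))
... | tri≈ _ sx≡a _ = contradiction sx≡a sx≢a
... | tri> _ _ a<sx = inj₁ (reflect-suc-suc (s≤s⁻¹ a<sx))

reflect-preserves-breakpoint : ∀ a {k x} → x < k → suc (reflect a k x) ≡ a → suc x ≡ a
reflect-preserves-breakpoint a {k} {x} x<k sy≡a = begin
  suc x                         ≡⟨ cong suc (reflect-involutive a x<k) ⟨
  suc (reflect a k (reflect a k x)) ≡⟨ cong suc (reflect-fixed k (≤-reflexive sy≡a)) ⟩
  suc (reflect a k x)           ≡⟨ sy≡a ⟩
  a                             ∎
  where open ≡-Reasoning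

reflectFin : ∀ {N} → ℕ → Fin N → Fin N
reflectFin a x = fromℕ< (reflect-< a (toℕ<n x))

toℕ-reflectFin : ∀ {N} a (x : Fin N) → toℕ (reflectFin a x) ≡ reflect a N (toℕ x)
toℕ-reflectFin a x = toℕ-fromℕ< (reflect-< a (toℕ<n x))

reflectFin-involutive : ∀ {N} a (x : Fin N) → reflectFin a (reflectFin a x) ≡ x
reflectFin-involutive {N} a x = toℕ-injective (begin
  toℕ (reflectFin a (reflectFin a x)) ≡⟨ toℕ-reflectFin a (reflectFin a x) ⟩
  reflect a N (toℕ (reflectFin a x))  ≡⟨ cong (reflect a N) (toℕ-reflectFin a x) ⟩
  reflect a N (reflect a N (toℕ x))   ≡⟨ reflect-involutive a (toℕ<n x) ⟩
  toℕ x                               ∎)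
  where open ≡-Reasoning

involutive⇒injective : ∀ {A : Set} {f : A → A} → (∀ x → f (f x) ≡ x) → Injective _≡_ _≡_ f
involutive⇒injective {f = f} inv {x} {y} fx≡fy = trans (sym (inv x)) (trans (cong f fx≡fy) (inv y))

image-∘-involution : ∀ {A B : Set} (f : A → B) {g : A → A} → (∀ x → g (g x) ≡ x) → ∀ y →
  ((∃ λ x → f x ≡ y) → (∃ λ x → f (g x) ≡ y)) × ((∃ λ x → f (g x) ≡ y) → (∃ λ x → f x ≡ y))
image-∘-involution f {g} inv y =
  (λ (x , fx≡y) → g x , trans (cong f (inv x)) fx≡y) , (λ (x , fgx≡y) → g x , fgx≡y)

⇔-trans : ∀ {A : Set} {P Q R : A → Set} → (∀ x → (P x → Q x) × (Q x → P x)) →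
  (∀ x → (Q x → R x) × (R x → Q x)) → ∀ x → (P x → R x) × (R x → P x)
⇔-trans P⇔Q Q⇔R x = proj₁ (Q⇔R x) ∘ proj₁ (P⇔Q x) , proj₂ (P⇔Q x) ∘ proj₂ (Q⇔R x)

∈tabulate⁻ : ∀ {N} (f : Fin N → Bool) {i} → i ∈ tabulate f → f i ≡ true
∈tabulate⁻ f {i} i∈ = trans (sym (lookup∘tabulate f i)) ([]=⇒lookup i∈)

∈tabulate⁺ : ∀ {N} (f : Fin N → Bool) {i} → f i ≡ true → i ∈ tabulate f
∈tabulate⁺ f {i} fi≡true = lookup⇒[]= i (tabulate f) (trans (lookup∘tabulate f i) fi≡true)

preimage : ∀ {a n} → (Fin a → Fin n) → Subset n → Subset a
preimage g p = tabulate (λ i → lookup p (g i))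

module _ {a n} (g : Fin a → Fin n) where

  ∈preimage⁺ : ∀ {p i} → g i ∈ p → i ∈ preimage g p
  ∈preimage⁺ {p} gi∈p = ∈tabulate⁺ (λ i → lookup p (g i)) ([]=⇒lookup gi∈p)

  ∈preimage⁻ : ∀ {p i} → i ∈ preimage g p → g i ∈ p
  ∈preimage⁻ {p} {i} i∈ = lookup⇒[]= (g i) p (∈tabulate⁻ (λ i → lookup p (g i)) i∈)

  preimage-⊆-minus : ∀ {p x} → (∀ i → g i ≢ x) → preimage g p ⊆ preimage g (p - x)
  preimage-⊆-minus {p} {x} g≢x i∈ = ∈preimage⁺ {p - x} (x∈p∧x≢y⇒x∈p-y (∈preimage⁻ {p} i∈) (g≢x _))

∣preimage∣≤∣p∣ : ∀ {a n} (g : Fin a → Fin n) → Injective _≡_ _≡_ g → ∀ p → ∣ preimage g p ∣ ≤ ∣ p ∣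
∣preimage∣<∣p∣ : ∀ {a n} (g : Fin a → Fin n) → Injective _≡_ _≡_ g →
  ∀ {p x} → x ∈ p → (∀ i → g i ≢ x) → ∣ preimage g p ∣ < ∣ p ∣

∣preimage∣≤∣p∣ {zero}  g g-inj p = z≤n
∣preimage∣≤∣p∣ {suc a} g g-inj p with lookup p (g fzero) in g0∈p
... | false = ∣preimage∣≤∣p∣ (g ∘ fsuc) (fsuc-injective ∘ g-inj) p
... | true  = ∣preimage∣<∣p∣ (g ∘ fsuc) (fsuc-injective ∘ g-inj)
  (lookup⇒[]= (g fzero) p g0∈p) (λ i → fzero≢fsuc ∘ sym ∘ g-inj)

∣preimage∣<∣p∣ g g-inj {p} {x} x∈p g≢x = begin-strict
  ∣ preimage g p ∣       ≤⟨ p⊆q⇒∣p∣≤∣q∣ (preimage-⊆-minus g {p} g≢x) ⟩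
  ∣ preimage g (p - x) ∣ ≤⟨ ∣preimage∣≤∣p∣ g g-inj (p - x) ⟩
  ∣ p - x ∣              <⟨ x∈p⇒∣p-x∣<∣p∣ x∈p ⟩
  ∣ p ∣                  ∎
  where open ≤-Reasoning

∣p∪q∣≤∣p∣+∣q∣ : ∀ {n} (p q : Subset n) → ∣ p ∪ q ∣ ≤ ∣ p ∣ + ∣ q ∣
∣p∪q∣≤∣p∣+∣q∣ []          []          = z≤n
∣p∪q∣≤∣p∣+∣q∣ (true ∷ p)  (true ∷ q)  =
  s≤s (≤-trans (∣p∪q∣≤∣p∣+∣q∣ p q) (+-monoʳ-≤ ∣ p ∣ (n≤1+n ∣ q ∣)))
∣p∪q∣≤∣p∣+∣q∣ (true ∷ p)  (false ∷ q) = s≤s (∣p∪q∣≤∣p∣+∣q∣ p q)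
∣p∪q∣≤∣p∣+∣q∣ (false ∷ p) (true ∷ q)  =
  ≤-trans (s≤s (∣p∪q∣≤∣p∣+∣q∣ p q)) (≤-reflexive (sym (+-suc ∣ p ∣ ∣ q ∣)))
∣p∪q∣≤∣p∣+∣q∣ (false ∷ p) (false ∷ q) = ∣p∪q∣≤∣p∣+∣q∣ p q

foldr-∨≡true⇒nonempty : ∀ {N} (p : Subset N) → foldr′ _∨_ false p ≡ true → Nonempty p
foldr-∨≡true⇒nonempty (true  ∷ p) _        = fzero , Vec.here
foldr-∨≡true⇒nonempty (false ∷ p) any≡true =
  Product.map fsuc Vec.there (foldr-∨≡true⇒nonempty p any≡true)

any⊎all : ∀ {A : Set} {P Q : A → Set} → (∀ x → P x ⊎ Q x) → ∀ xs → Any P xs ⊎ All Q xs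
any⊎all P⊎Q []       = inj₂ []
any⊎all P⊎Q (x ∷ xs) with P⊎Q x | any⊎all P⊎Q xs
... | inj₁ px | _          = inj₁ (here px)
... | inj₂ _  | inj₁ anyP  = inj₁ (there anyP)
... | inj₂ qx | inj₂ allQ  = inj₂ (qx ∷ allQ)

module _ {n m} {H : Hypergraph n m} where

  EndOf : (Q : BergePath H) → Fin (len Q) → Fin n → Set
  EndOf Q j x = x ≡ vert Q (inject₁ j) ⊎ x ≡ vert Q (fsuc j)

  endOf-∈ : ∀ Q {j x} → EndOf Q j x → x ∈ H (edge Q j)
  endOf-∈ Q (inj₁ refl) = left∈ Q _
  endOf-∈ Q (inj₂ refl) = right∈ Q _

  Traverses : BergePath H → (Q : BergePath H) → Fin (len Q) → Set
  Traverses Q′ Q j = ∃ λ j′ → edge Q′ j′ ≡ edge Q j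
    × EndOf Q j (vert Q′ (inject₁ j′)) × EndOf Q j (vert Q′ (fsuc j′))

  traverses-trans : ∀ {Q″ Q′ Q i} (t : Traverses Q′ Q i) → Traverses Q″ Q′ (proj₁ t) → Traverses Q″ Q i
  traverses-trans {Q″} {Q′} {Q} {i} (j , e , l , r) (j′ , e′ , l′ , r′) =
    j′ , trans e′ e , end l′ , end r′
    where
    end : ∀ {x} → EndOf Q′ j x → EndOf Q i x
    end (inj₁ refl) = l
    end (inj₂ refl) = r

  -- Q reversed from vertex a on.  Every edge except edge a - 1 keeps its two ends; edge a - 1
  -- now joins vertex a - 1 to the old last vertex, whence the hypothesis.
  module SegmentReversal (Q : BergePath H) (a : ℕ)
      (lastV∈breakpoint : ∀ i → suc (toℕ i) ≡ a → lastV Q ∈ H (edge Q i)) where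

    σ : Fin (suc (len Q)) → Fin (suc (len Q))
    σ = reflectFin a

    π : Fin (len Q) → Fin (len Q)
    π = reflectFin a

    endOf : ∀ {j y} → SlotEnd (toℕ j) (toℕ y) → EndOf Q j (vert Q y)
    endOf {j} (inj₁ y≡j) = inj₁ (cong (vert Q) (toℕ-injective (trans y≡j (sym (toℕ-inject₁ j)))))
    endOf     (inj₂ y≡sj) = inj₂ (cong (vert Q) (toℕ-injective y≡sj))

    leftEnd : ∀ i → EndOf Q (π i) (vert Q (σ (inject₁ i)))
    leftEnd i = endOf (subst₂ SlotEnd (sym (toℕ-reflectFin a i))
      (sym (trans (toℕ-reflectFin a (inject₁ i)) (cong (reflect a _) (toℕ-inject₁ i))))
      (reflect-left a (toℕ<n i)))

    rightEnd : ∀ i → suc (toℕ i) ≢ a → EndOf Q (π i) (vert Q (σ (fsuc i)))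
    rightEnd i si≢a = endOf (subst₂ SlotEnd (sym (toℕ-reflectFin a i)) (sym (toℕ-reflectFin a (fsuc i)))
      (reflect-right a (toℕ<n i) si≢a))

    rightEnd∈ : ∀ i → vert Q (σ (fsuc i)) ∈ H (edge Q (π i))
    rightEnd∈ i with suc (toℕ i) ≟ a
    ... | no  si≢a = endOf-∈ Q (rightEnd i si≢a)
    ... | yes si≡a =
      subst₂ (λ x j → vert Q x ∈ H (edge Q j)) (sym σ-last) (sym π-fixed) (lastV∈breakpoint i si≡a)
      where
      σ-last : σ (fsuc i) ≡ fromℕ (len Q)
      σ-last = toℕ-injective (begin
        toℕ (σ (fsuc i))                     ≡⟨ toℕ-reflectFin a (fsuc i) ⟩
        reflect a (suc (len Q)) (suc (toℕ i)) ≡⟨ cong (reflect a _) si≡a ⟩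
        reflect a (suc (len Q)) a             ≡⟨ reflect-start (subst (_≤ len Q) si≡a (toℕ<n i)) ⟩
        len Q                                 ≡⟨ toℕ-fromℕ (len Q) ⟨
        toℕ (fromℕ (len Q))                   ∎)
        where open ≡-Reasoning
      π-fixed : π i ≡ i
      π-fixed = toℕ-injective (trans (toℕ-reflectFin a i) (reflect-fixed (len Q) (≤-reflexive si≡a)))

    reversed : BergePath H
    reversed = record
      { len      = len Q
      ; vert     = λ x → vert Q (σ x)
      ; edge     = λ i → edge Q (π i)
      ; vert-inj = λ e → involutive⇒injective (reflectFin-involutive a) (vert-inj Q e)
      ; edge-inj = λ e → involutive⇒injective (reflectFin-involutive a) (edge-inj Q e)
      ; left∈    = λ i → endOf-∈ Q (leftEnd i)
      ; right∈   = rightEnd∈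
      }

    sameVertexSet : SameVertexSet Q reversed
    sameVertexSet = image-∘-involution (vert Q) (reflectFin-involutive a)

    sameEdgeSet : SameEdgeSet Q reversed
    sameEdgeSet = image-∘-involution (edge Q) (reflectFin-involutive a)

    traverses : ∀ j → suc (toℕ j) ≢ a → Traverses reversed Q j
    traverses j sj≢a = π j , cong (edge Q) (reflectFin-involutive a j) ,
      unπ (leftEnd (π j)) , unπ (rightEnd (π j) (sj≢a ∘ breakpoint))
      where
      unπ : ∀ {x} → EndOf Q (π (π j)) x → EndOf Q j x
      unπ {x} = subst (λ i → EndOf Q i x) (reflectFin-involutive a j)
      breakpoint : suc (toℕ (π j)) ≡ a → suc (toℕ j) ≡ a
      breakpoint e = reflect-preserves-breakpoint a (toℕ<n j) (trans (cong suc (sym (toℕ-reflectFin a j))) e)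

    firstV-reversed : 0 < a → firstV reversed ≡ firstV Q
    firstV-reversed 0<a = cong (vert Q) (toℕ-injective (trans (toℕ-reflectFin a fzero) (reflect-fixed _ 0<a)))

    toℕ-σ-last : a ≤ len Q → toℕ (σ (fromℕ (len Q))) ≡ a
    toℕ-σ-last a≤k = trans (toℕ-reflectFin a _) (trans (cong (reflect a _) (toℕ-fromℕ _)) (reflect-end a≤k))

  inFamily-self : ∀ (Q : BergePath H) → InFamily Q (firstV Q) Q
  inFamily-self Q = refl , (λ _ → id , id) , (λ _ → id , id)

  module _ (Q : BergePath H) where
    open SegmentReversal Q 0 (λ _ ())

    reverse : BergePath H
    reverse = reversed

    firstV-reverse : firstV reverse ≡ lastV Q
    firstV-reverse = cong (vert Q) (toℕ-injective (trans (toℕ-reflectFin 0 fzero) (sym (toℕ-fromℕ (len Q)))))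

    inFamily-reverse : InFamily Q (lastV Q) reverse
    inFamily-reverse = firstV-reverse , sameVertexSet , sameEdgeSet

    lastV-reverse : lastV reverse ≡ firstV Q
    lastV-reverse = cong (vert Q) (toℕ-injective (toℕ-σ-last z≤n))

    reverse-traverses : ∀ j → Traverses reverse Q j
    reverse-traverses j = traverses j λ ()

  module _ (Q : BergePath H) (p : Fin (len Q)) (lastV∈p : lastV Q ∈ H (edge Q p)) where
    private
      lastV∈breakpoint : ∀ i → suc (toℕ i) ≡ suc (toℕ p) → lastV Q ∈ H (edge Q i)
      lastV∈breakpoint i si≡sp =
        subst (λ j → lastV Q ∈ H (edge Q j)) (toℕ-injective (suc-injective (sym si≡sp))) lastV∈p

    open SegmentReversal Q (suc (toℕ p)) lastV∈breakpoint

    rotate : BergePath H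
    rotate = reversed

    inFamily-rotate : ∀ {P v₀} → InFamily P v₀ Q → InFamily P v₀ rotate
    inFamily-rotate (first≡v₀ , sameV , sameE) =
      trans (firstV-reversed (s≤s z≤n)) first≡v₀ , ⇔-trans sameV sameVertexSet , ⇔-trans sameE sameEdgeSet

    lastV-rotate : lastV rotate ≡ vert Q (fsuc p)
    lastV-rotate = cong (vert Q) (toℕ-injective (toℕ-σ-last (toℕ<n p)))

    rotate-traverses : ∀ j → j ≢ p → Traverses rotate Q j
    rotate-traverses j j≢p = traverses j (j≢p ∘ toℕ-injective ∘ suc-injective)

  ∈τset⁻ : ∀ {x} (L : List (BergePath H)) → x ∈ τset L → Any (λ Q → τ Q ≡ x) L
  ∈τset⁻ []      x∈ = contradiction x∈ ∉⊥
  ∈τset⁻ (Q ∷ L) x∈ with x∈p∪q⁻ ⁅ τ Q ⁆ (τset L) x∈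
  ... | inj₁ x∈⁅τQ⁆ = here (sym (x∈⁅y⁆⇒x≡y (τ Q) x∈⁅τQ⁆))
  ... | inj₂ x∈τL   = there (∈τset⁻ L x∈τL)

  τ∈τset : ∀ Q (L : List (BergePath H)) → τ Q ∈ τset (Q ∷ L)
  τ∈τset Q L = x∈p∪q⁺ (inj₁ (x∈⁅x⁆ (τ Q)))

  ∈nbrEdges⁻ : ∀ (P : BergePath H) {S i} → i ∈ NbrEdges P S → ∃ λ x → x ∈ H (edge P i) × x ∈ S
  ∈nbrEdges⁻ P {S} {i} i∈ = Product.map₂ (x∈p∩q⁻ _ S)
    (foldr-∨≡true⇒nonempty _ (∈tabulate⁻ (λ i → meets {H = H} (H (edge P i)) S) i∈))

module _ {n m} {H : Hypergraph n m} (P : BergePath H) where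

  leftEnds : Subset n → Subset (len P)
  leftEnds = preimage (λ i → vert P (inject₁ i))

  rightEnds : Subset n → Subset (len P)
  rightEnds = preimage (λ i → vert P (fsuc i))

  ContainsEnd : Subset n → Set
  ContainsEnd R = firstV P ∈ R ⊎ lastV P ∈ R

  ∣ends∣<2∣R∣ : ∀ {R} → ContainsEnd R → ∣ leftEnds R ∣ + ∣ rightEnds R ∣ < ∣ R ∣ + ∣ R ∣
  ∣ends∣<2∣R∣ {R} (inj₁ first∈R) = +-mono-≤-<
    (∣preimage∣≤∣p∣ _ (inject₁-injective ∘ vert-inj P) R)
    (∣preimage∣<∣p∣ _ (fsuc-injective ∘ vert-inj P) first∈R (λ i → fzero≢fsuc ∘ sym ∘ vert-inj P))
  ∣ends∣<2∣R∣ {R} (inj₂ last∈R) = +-mono-<-≤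
    (∣preimage∣<∣p∣ _ (inject₁-injective ∘ vert-inj P) last∈R (λ i → fromℕ≢inject₁ ∘ sym ∘ vert-inj P))
    (∣preimage∣≤∣p∣ _ (fsuc-injective ∘ vert-inj P) R)

  ∣nbrEdges∣≤2∣R∣∸1 : ∀ {R} → NbrEdges P R ⊆ leftEnds R ∪ rightEnds R → ContainsEnd R →
    ∣ NbrEdges P R ∣ ≤ 2 * ∣ R ∣ ∸ 1
  ∣nbrEdges∣≤2∣R∣∸1 {R} N⊆ends end∈R = ∸-monoˡ-≤ 1 (begin-strict
    ∣ NbrEdges P R ∣                  ≤⟨ p⊆q⇒∣p∣≤∣q∣ N⊆ends ⟩
    ∣ leftEnds R ∪ rightEnds R ∣      ≤⟨ ∣p∪q∣≤∣p∣+∣q∣ (leftEnds R) (rightEnds R) ⟩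
    ∣ leftEnds R ∣ + ∣ rightEnds R ∣  <⟨ ∣ends∣<2∣R∣ end∈R ⟩
    ∣ R ∣ + ∣ R ∣                     ≡⟨ cong (∣ R ∣ +_) (+-identityʳ ∣ R ∣) ⟨
    2 * ∣ R ∣                         ∎)
    where open ≤-Reasoning

module Pósa {n m} {H : Hypergraph n m} (P : BergePath H) (v₀ : Fin n) where

  Intact : Subset n → BergePath H → Set
  Intact R Q = ∀ i → vert P (inject₁ i) ∉ R → vert P (fsuc i) ∉ R → Traverses Q P i

  Admissible : Subset n → BergePath H → Set
  Admissible R Q = InFamily P v₀ Q × Intact R Q

  Closed : Subset n → BergePath H → Set
  Closed R Q = ∀ j → τ Q ∈ H (edge Q j) → vert Q (fsuc j) ∈ R

  Escapes : Subset n → BergePath H → Set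
  Escapes R Q = ∃ λ j → τ Q ∈ H (edge Q j) × vert Q (fsuc j) ∉ R

  escapes⊎closed : ∀ R Q → Escapes R Q ⊎ Closed R Q
  escapes⊎closed R Q with any? (λ j → τ Q ∈? H (edge Q j) ×-dec ¬? (vert Q (fsuc j) ∈? R))
  ... | yes escape = inj₁ escape
  ... | no ¬escape = inj₂ λ j τ∈ →
    decidable-stable (vert Q (fsuc j) ∈? R) (λ out → ¬escape (j , τ∈ , out))

  endOf-∉ : ∀ {R i x} → vert P (inject₁ i) ∉ R → vert P (fsuc i) ∉ R → EndOf P i x → x ∉ R
  endOf-∉ left∉ _      (inj₁ refl) = left∉
  endOf-∉ _     right∉ (inj₂ refl) = right∉

  intact-⊆ : ∀ {R R′} Q → R ⊆ R′ → Intact R Q → Intact R′ Q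
  intact-⊆ Q R⊆R′ intact i left∉ right∉ = intact i (left∉ ∘ R⊆R′) (right∉ ∘ R⊆R′)

  intact-transfer : ∀ {R} Q Q′ → Intact R Q → (∀ j → vert Q (fsuc j) ∉ R → Traverses Q′ Q j) →
    Intact R Q′
  intact-transfer Q Q′ intact transfer i left∉ right∉ = via (intact i left∉ right∉)
    where
    via : Traverses Q P i → Traverses Q′ P i
    via t@(j , _ , _ , right) = traverses-trans {Q″ = Q′} {Q} {P} t (transfer j (endOf-∉ left∉ right∉ right))

  admissible-rotate : ∀ {R R′} Q j (τ∈ : τ Q ∈ H (edge Q j)) → R ⊆ R′ → τ (rotate Q j τ∈) ∈ R′ →
    Admissible R Q → Admissible R′ (rotate Q j τ∈)
  admissible-rotate Q j τ∈ R⊆R′ τ′∈R′ (family , intact) =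
    inFamily-rotate Q j τ∈ {P} family ,
    intact-transfer Q (rotate Q j τ∈) (intact-⊆ Q R⊆R′ intact) λ j′ out →
      rotate-traverses Q j τ∈ j′ λ { refl → out (subst (_∈ _) (lastV-rotate Q j τ∈) τ′∈R′) }

  Extension : List (BergePath H) → Set
  Extension L = ∃ λ Q′ → τset (Q′ ∷ L) ⊃ τset L × All (Admissible (τset (Q′ ∷ L))) (Q′ ∷ L)

  extend : ∀ {L} Q → Admissible (τset L) Q → Escapes (τset L) Q → All (Admissible (τset L)) L →
    Extension L
  extend {L} Q admissibleQ (j , τ∈ , out) admissible =
    Q′ , (R⊆R′ , τ Q′ , τ∈τset Q′ L , subst (_∉ τset L) (sym (lastV-rotate Q j τ∈)) out) ,
    admissible-rotate Q j τ∈ R⊆R′ (τ∈τset Q′ L) admissibleQ ∷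
    All.map (λ {Q″} → Product.map₂ (intact-⊆ Q″ R⊆R′)) admissible
    where
    Q′ = rotate Q j τ∈
    R⊆R′ : τset L ⊆ τset (Q′ ∷ L)
    R⊆R′ = q⊆p∪q ⁅ τ Q′ ⁆ (τset L)

  record ClosedFamily : Set where
    field
      paths    : List (BergePath H)
      nonempty : ∃ λ Q → ∃ λ Qs → paths ≡ Q ∷ Qs
      members  : All (λ Q → Admissible (τset paths) Q × Closed (τset paths) Q) paths
      end∈     : ContainsEnd P (τset paths)

  close : ∀ L → Acc _⊃_ (τset L) → (∃ λ Q → ∃ λ Qs → L ≡ Q ∷ Qs) →
    All (Admissible (τset L)) L → ContainsEnd P (τset L) → ClosedFamily
  close L (acc larger) nonempty admissible end∈ =
    Sum.[ grow , stop ]′ (any⊎all (escapes⊎closed (τset L)) L)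
    where
    stop : All (Closed (τset L)) L → ClosedFamily
    stop closed = record
      { paths = L ; nonempty = nonempty ; members = All.zip (admissible , closed) ; end∈ = end∈ }
    continue : Extension L → ClosedFamily
    continue (Q′ , R⊂R′ , admissible′) =
      close (Q′ ∷ L) (larger R⊂R′) (Q′ , L , refl) admissible′ (Sum.map (proj₁ R⊂R′) (proj₁ R⊂R′) end∈)
    grow : Any (Escapes (τset L)) L → ClosedFamily
    grow escaping = continue (extend (Any.lookup escaping) (proj₁ both) (proj₂ both) admissible)
      where both = lookupAny admissible escaping

  start : IsTerminal v₀ P →
    ∃ λ Q₀ → InFamily P v₀ Q₀ × (∀ i → Traverses Q₀ P i) × (τ Q₀ ≡ firstV P ⊎ τ Q₀ ≡ lastV P)
  start (inj₁ refl) = P , inFamily-self P , (λ i → i , refl , inj₁ refl , inj₂ refl) , inj₂ refl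
  start (inj₂ refl) = reverse P , inFamily-reverse P , reverse-traverses P , inj₁ (lastV-reverse P)

  closure : IsTerminal v₀ P → ClosedFamily
  closure terminal with start terminal
  ... | Q₀ , family , traverses , τQ₀ = close (Q₀ ∷ []) (⊃-wellFounded _) (Q₀ , [] , refl)
    ((family , λ i _ _ → traverses i) ∷ []) (Sum.map end∈ end∈ τQ₀)
    where
    end∈ : ∀ {x} → τ Q₀ ≡ x → x ∈ τset (Q₀ ∷ [])
    end∈ refl = τ∈τset Q₀ []

  slotEnd∈ : ∀ {R} Q {i} → Intact R Q → Closed R Q → τ Q ∈ H (edge P i) →
    vert P (inject₁ i) ∈ R ⊎ vert P (fsuc i) ∈ R
  slotEnd∈ {R} Q {i} intact closed τ∈ with vert P (inject₁ i) ∈? R | vert P (fsuc i) ∈? R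
  ... | yes left∈R | _           = inj₁ left∈R
  ... | no _       | yes right∈R = inj₂ right∈R
  ... | no left∉R  | no right∉R  =
    let j , e , _ , right = intact i left∉R right∉R
    in contradiction (closed j (subst (λ f → τ Q ∈ H f) (sym e) τ∈)) (endOf-∉ left∉R right∉R right)

  nbrEdges⊆ends : (F : ClosedFamily) → let R = τset (ClosedFamily.paths F) in
    NbrEdges P R ⊆ leftEnds P R ∪ rightEnds P R
  nbrEdges⊆ends F {i} i∈N =
    let x , x∈E , x∈R = ∈nbrEdges⁻ P i∈N
        tip = ∈τset⁻ paths x∈R
        ((_ , intact) , closed) , τ≡x = lookupAny members tip
    in x∈p∪q⁺ (Sum.map (∈preimage⁺ _) (∈preimage⁺ _)
         (slotEnd∈ (Any.lookup tip) intact closed (subst (λ y → y ∈ H (edge P i)) (sym τ≡x) x∈E)))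
    where open ClosedFamily F

lemma3p8 : ∀ {n m} (r : ℕ) (H : Hypergraph n m) → Uniform r H → Simple H →
    (P : BergePath H) (v₀ : Fin n) → IsTerminal v₀ P →
    ∃ λ (𝒫′ : List (BergePath H)) →
      (∃ λ Q → ∃ λ Qs → 𝒫′ ≡ Q ∷ Qs)
      × All (InFamily P v₀) 𝒫′
      × ∣ NbrEdges P (τset 𝒫′) ∣ ≤ 2 * ∣ τset 𝒫′ ∣ ∸ 1
lemma3p8 r H _ _ P v₀ terminal =
  paths , nonempty , All.map (proj₁ ∘ proj₁) members , ∣nbrEdges∣≤2∣R∣∸1 P (nbrEdges⊆ends family) end∈
  where
  open Pósa P v₀
  family = closure terminal
  open ClosedFamily family
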